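{- There is an absolute constant $c>0$ such that for every sufficiently large integer $n$ there exist rational numbers $p_1,\dots,p_n,q_1,\dots,q_n\in\mathbb{Q}[n]$ such that $(p_1+\dots+p_n)-(q_1+\dots+q_n)$ is positive and at most $2^{ -cn/\log n}$.
   Context: For a positive integer $W$, $\mathbb{Q}[W]$ is the set of rationals $p/q$ with integers $|p|<W$ and $0<q<W$. -}

module Defs where

open import Data.Nat as ℕ using (ℕ; zero; suc)
open import Data.Integer as ℤ using (ℤ; +_)
open import Data.Fin using (Fin; zero; suc)
open import Data.Rational using (ℚ; _+_; _/_; 0ℚ)
open import Data.Product using (Σ; _×_)
open import Relation.Binary.PropositionalEquality using (_≡_)

-- r ∈ ℚ[W]  :⇔  r = a / b  with integers |a| < W and 0 < b < W
-- (b is written suc d, so 0 < b is automatic).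
InQ : ℕ → ℚ → Set
InQ W r = Σ ℤ λ a → Σ ℕ λ d →
  (ℤ.∣ a ∣ ℕ.< W) × (suc d ℕ.< W) × (r ≡ a / suc d)

sumℚ : (n : ℕ) → (Fin n → ℚ) → ℚ
sumℚ zero    f = 0ℚ
sumℚ (suc n) f = f zero + sumℚ n (λ i → f (suc i))

ℕtoℚ : ℕ → ℚ
ℕtoℚ m = + m / 1

{-# OPTIONS --safe #-}
-- The Beta integral ∫₀¹ xᵏ (1 − x)ᵏ dx = k!² / (2k+1)! ≤ 2⁻ᵏ expands, through the
-- binomial theorem, into the sum Σⱼ (−1)ʲ C(k,j) / (k+1+j) of k+1 fractions whose
-- denominators are at most 2k+1.  Splitting each fraction into its fractional part
-- (a rational in ℚ[n] when 2k+1 < n) and an integer, the tiny positive value becomes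
-- the difference of the sum of the fractional parts and one integer of absolute
-- value below n.  Taking k ≈ n/4 gives a gap of 2^(−n/4).
module Submission where

open import Defs
open import Data.Nat as ℕ using (ℕ; zero; suc; _≥_; _^_) renaming (_*_ to _*ℕ_)
import Data.Nat.Properties as ℕₚ
open import Data.Nat.DivMod using (m%n<n; m≡m%n+[m/n]*n; /-monoˡ-≤)
open import Data.Nat.Logarithm using (⌈log₂_⌉; ⌈log₂⌉-mono-≤; ⌈log₂2^n⌉≡n)
open import Data.Nat.Tactic.RingSolver using () renaming (solve-∀ to ℕ-solve)
open import Data.Integer as ℤ using (ℤ; +_)
import Data.Integer.Properties as ℤₚ
open import Data.Integer.DivMod using (_%ℕ_; _/ℕ_; n%ℕd<d; a≡a%ℕn+[a/ℕn]*n)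
open import Data.Integer.Tactic.RingSolver using () renaming (solve-∀ to ℤ-solve)
import Data.Rational as ℚ
import Data.Rational.Properties as ℚₚ
import Data.Rational.Unnormalised as ℚᵘ
import Data.Rational.Unnormalised.Properties as ℚᵘₚ
open import Data.Rational.Unnormalised.Solver using (module +-*-Solver)
open import Data.Fin using (Fin; zero; suc)
open import Data.List using (List; []; _∷_; length; foldr)
open import Data.List.Relation.Unary.All using (All; []; _∷_)
open import Data.Product using (Σ; _×_; _,_)
open import Relation.Binary.PropositionalEquality

module BetaIntegral where
  open ℚᵘ using (ℚᵘ; mkℚᵘ; 0ℚᵘ; 1ℚᵘ; _+_; _-_; -_; _*_; _≃_; _≤_; _<_; *≡*; *≤*; *<*)
  open ℚᵘₚ using (≃-refl; ≃-sym; ≃-trans; +-cong; +-congʳ; -‿cong)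
  open +-*-Solver using (solve; _:=_; _:+_; _:-_; :-_)

  -- Polynomials over ℤ are coefficient lists, constant term first.
  infixl 6 _⊖_
  _⊖_ : List ℤ → List ℤ → List ℤ
  as       ⊖ []       = as
  []       ⊖ (b ∷ bs) = ℤ.- b ∷ [] ⊖ bs
  (a ∷ as) ⊖ (b ∷ bs) = a ℤ.- b ∷ as ⊖ bs

  length-⊖ : ∀ as bs → length as ℕ.≤ length bs → length (as ⊖ bs) ≡ length bs
  length-⊖ []       []       _           = refl
  length-⊖ []       (b ∷ bs) _           = cong suc (length-⊖ [] bs ℕ.z≤n)
  length-⊖ (a ∷ as) (b ∷ bs) (ℕ.s≤s ≤bs) = cong suc (length-⊖ as bs ≤bs)

  -- (1 − x)ᵏ⁺¹ = (1 − x)ᵏ − x (1 − x)ᵏ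
  oneMinusXPow : ℕ → List ℤ
  oneMinusXPow zero    = + 1 ∷ []
  oneMinusXPow (suc k) = oneMinusXPow k ⊖ (+ 0 ∷ oneMinusXPow k)

  length-oneMinusXPow : ∀ k → length (oneMinusXPow k) ≡ suc k
  length-oneMinusXPow zero    = refl
  length-oneMinusXPow (suc k) =
    trans (length-⊖ (oneMinusXPow k) (+ 0 ∷ oneMinusXPow k) (ℕₚ.n≤1+n _))
          (cong suc (length-oneMinusXPow k))

  -- moment f s = ∫₀¹ xˢ f(x) dx; recall that mkℚᵘ c d stands for c / (d + 1).
  moment : List ℤ → ℕ → ℚᵘ
  moment []       s = 0ℚᵘ
  moment (c ∷ cs) s = mkℚᵘ c s + moment cs (suc s)

  mkℚᵘ-homo-− : ∀ a b s → mkℚᵘ (a ℤ.- b) s ≃ mkℚᵘ a s - mkℚᵘ b s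
  mkℚᵘ-homo-− a b s = *≡* (cross a b (+ suc s))
    where
    cross : ∀ a b d → (a ℤ.- b) ℤ.* (d ℤ.* d) ≡ (a ℤ.* d ℤ.+ ℤ.- b ℤ.* d) ℤ.* d
    cross = ℤ-solve

  moment-⊖ : ∀ as bs s → moment (as ⊖ bs) s ≃ moment as s - moment bs s
  moment-⊖ as       []       s = ≃-sym (ℚᵘₚ.+-identityʳ (moment as s))
  moment-⊖ []       (b ∷ bs) s =
    ≃-trans (+-congʳ (mkℚᵘ (ℤ.- b) s) (moment-⊖ [] bs (suc s)))
            (rearrange (mkℚᵘ b s) 0ℚᵘ (moment bs (suc s)))
    where
    rearrange : ∀ x z y → (- x) + (z - y) ≃ z - (x + y)
    rearrange = solve 3 (λ x z y → (:- x) :+ (z :- y) := z :- (x :+ y)) ≃-refl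
  moment-⊖ (a ∷ as) (b ∷ bs) s =
    ≃-trans (+-cong (mkℚᵘ-homo-− a b s) (moment-⊖ as bs (suc s)))
            (rearrange (mkℚᵘ a s) (mkℚᵘ b s) (moment as (suc s)) (moment bs (suc s)))
    where
    rearrange : ∀ x y u v → (x - y) + (u - v) ≃ (x + u) - (y + v)
    rearrange = solve 4 (λ x y u v → (x :- y) :+ (u :- v) := (x :+ u) :- (y :+ v)) ≃-refl

  moment-shift : ∀ cs s → moment (+ 0 ∷ cs) s ≃ moment cs (suc s)
  moment-shift cs s =
    ≃-trans (ℚᵘₚ.+-congˡ (moment cs (suc s)) (*≡* {mkℚᵘ (+ 0) s} {0ℚᵘ} refl))
            (ℚᵘₚ.+-identityˡ (moment cs (suc s)))

  moment-oneMinusXPow-suc : ∀ k s →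
    moment (oneMinusXPow (suc k)) s ≃ moment (oneMinusXPow k) s - moment (oneMinusXPow k) (suc s)
  moment-oneMinusXPow-suc k s =
    ≃-trans (moment-⊖ (oneMinusXPow k) (+ 0 ∷ oneMinusXPow k) s)
            (+-congʳ (moment (oneMinusXPow k) s) (-‿cong (moment-shift (oneMinusXPow k) s)))

  -- rising k s = (s+1)(s+2)⋯(s+k+1), written as the successor of risingPred k s
  -- so that it can serve as the denominator of a ℚᵘ.
  risingPred : ℕ → ℕ → ℕ
  risingPred zero    s = s
  risingPred (suc k) s = (s ℕ.+ suc k) ℕ.+ risingPred k s ℕ.* suc (s ℕ.+ suc k)

  rising : ℕ → ℕ → ℕ
  rising k s = suc (risingPred k s)

  rising-sucˡ : ∀ k s → rising (suc k) s ≡ suc s ℕ.* rising k (suc s)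
  rising-sucˡ zero    s = cong (λ x → suc s ℕ.* suc x) (ℕₚ.+-comm s 1)
  rising-sucˡ (suc k) s = begin
    rising (suc k) s ℕ.* suc (s ℕ.+ suc (suc k))
      ≡⟨ cong (ℕ._* suc (s ℕ.+ suc (suc k))) (rising-sucˡ k s) ⟩
    suc s ℕ.* rising k (suc s) ℕ.* suc (s ℕ.+ suc (suc k))
      ≡⟨ ℕₚ.*-assoc (suc s) (rising k (suc s)) _ ⟩
    suc s ℕ.* (rising k (suc s) ℕ.* suc (s ℕ.+ suc (suc k)))
      ≡⟨ cong (λ x → suc s ℕ.* (rising k (suc s) ℕ.* suc x)) (ℕₚ.+-suc s (suc k)) ⟩
    suc s ℕ.* rising (suc k) (suc s)
      ∎
    where open ≡-Reasoning

  -- beta k s = k! / ((s+1)⋯(s+k+1)) = ∫₀¹ xˢ (1 − x)ᵏ dx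
  beta : ℕ → ℕ → ℚᵘ
  beta k s = mkℚᵘ (+ (k ℕ.!)) (risingPred k s)

  -- With A = rising k s, B = rising k (s+1), t = s+1, K = k+1 and f = k!, this is
  -- K f / (A (t+K)) = f / A − f / B cross-multiplied, using A (t+K) = t B.
  beta-suc : ∀ k s → beta (suc k) s ≃ beta k s - beta k (suc s)
  beta-suc k s = *≡* (begin
    + (suc k ℕ.!) ℤ.* (A ℤ.* B)
      ≡⟨ cong (ℤ._* (A ℤ.* B)) (ℤₚ.pos-* (suc k) (k ℕ.!)) ⟩
    K ℤ.* f ℤ.* (A ℤ.* B)
      ≡⟨ expand₁ f A B t K ⟩
    f ℤ.* B ℤ.* (A ℤ.* (t ℤ.+ K)) ℤ.- f ℤ.* A ℤ.* (t ℤ.* B)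
      ≡⟨ cong (λ y → f ℤ.* B ℤ.* (A ℤ.* (t ℤ.+ K)) ℤ.- f ℤ.* A ℤ.* y) (sym A[t+K]≡tB) ⟩
    f ℤ.* B ℤ.* (A ℤ.* (t ℤ.+ K)) ℤ.- f ℤ.* A ℤ.* (A ℤ.* (t ℤ.+ K))
      ≡⟨ expand₂ f A B (A ℤ.* (t ℤ.+ K)) ⟩
    (f ℤ.* B ℤ.+ ℤ.- f ℤ.* A) ℤ.* (A ℤ.* (t ℤ.+ K))
      ∎)
    where
    open ≡-Reasoning
    f = + (k ℕ.!)
    A = + rising k s
    B = + rising k (suc s)
    t = + suc s
    K = + suc k
    A[t+K]≡tB : A ℤ.* (t ℤ.+ K) ≡ t ℤ.* B
    A[t+K]≡tB = cong +_ (rising-sucˡ k s)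
    expand₁ : ∀ f A B t K →
      K ℤ.* f ℤ.* (A ℤ.* B) ≡ f ℤ.* B ℤ.* (A ℤ.* (t ℤ.+ K)) ℤ.- f ℤ.* A ℤ.* (t ℤ.* B)
    expand₁ = ℤ-solve
    expand₂ : ∀ f A B X → f ℤ.* B ℤ.* X ℤ.- f ℤ.* A ℤ.* X ≡ (f ℤ.* B ℤ.+ ℤ.- f ℤ.* A) ℤ.* X
    expand₂ = ℤ-solve

  moment-oneMinusXPow : ∀ k s → moment (oneMinusXPow k) s ≃ beta k s
  moment-oneMinusXPow zero    s = ℚᵘₚ.+-identityʳ (mkℚᵘ (+ 1) s)
  moment-oneMinusXPow (suc k) s = begin
    moment (oneMinusXPow (suc k)) s
      ≈⟨ moment-oneMinusXPow-suc k s ⟩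
    moment (oneMinusXPow k) s - moment (oneMinusXPow k) (suc s)
      ≈⟨ +-cong (moment-oneMinusXPow k s) (-‿cong (moment-oneMinusXPow k (suc s))) ⟩
    beta k s - beta k (suc s)
      ≈⟨ beta-suc k s ⟨
    beta (suc k) s
      ∎
    where open ℚᵘₚ.≃-Reasoning

  2^k*k!≤rising : ∀ k s → k ℕ.≤ s → 2 ℕ.^ k ℕ.* k ℕ.! ℕ.≤ rising k s
  2^k*k!≤rising zero    s _   = ℕ.s≤s ℕ.z≤n
  2^k*k!≤rising (suc k) s k<s = begin
    2 ℕ.^ suc k ℕ.* suc k ℕ.!            ≡⟨ regroup (2 ℕ.^ k) (k ℕ.!) k ⟩
    2 ℕ.^ k ℕ.* k ℕ.! ℕ.* (2 ℕ.* suc k)  ≤⟨ ℕₚ.*-mono-≤ (2^k*k!≤rising k s (ℕₚ.<⇒≤ k<s)) 2[k+1]≤ ⟩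
    rising k s ℕ.* suc (s ℕ.+ suc k)     ∎
    where
    open ℕₚ.≤-Reasoning
    regroup : ∀ a b c → 2 ℕ.* a ℕ.* ((1 ℕ.+ c) ℕ.* b) ≡ a ℕ.* b ℕ.* (2 ℕ.* (1 ℕ.+ c))
    regroup = ℕ-solve
    2[k+1]≤ : 2 ℕ.* suc k ℕ.≤ suc (s ℕ.+ suc k)
    2[k+1]≤ = begin
      2 ℕ.* suc k        ≡⟨ cong (suc k ℕ.+_) (ℕₚ.+-identityʳ (suc k)) ⟩
      suc k ℕ.+ suc k    ≤⟨ ℕₚ.+-monoˡ-≤ (suc k) k<s ⟩
      s ℕ.+ suc k        <⟨ ℕₚ.n<1+n _ ⟩
      suc (s ℕ.+ suc k)  ∎

  beta-positive : ∀ k s → 0ℚᵘ < beta k s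
  beta-positive k s = *<* (subst (ℤ._<_ (+ 0)) (sym (ℤₚ.*-identityʳ (+ (k ℕ.!)))) (ℤ.+<+ (ℕₚ.1≤n! k)))

  beta≤1 : ∀ k s → k ℕ.≤ s → beta k s ≤ 1ℚᵘ
  beta≤1 k s k≤s = *≤* (subst₂ ℤ._≤_ (sym (ℤₚ.*-identityʳ (+ (k ℕ.!)))) (sym (ℤₚ.*-identityˡ (+ rising k s)))
    (ℤ.+≤+ (ℕₚ.≤-trans (ℕₚ.m≤n*m (k ℕ.!) (2 ℕ.^ k) {{ℕₚ.m^n≢0 2 k}}) (2^k*k!≤rising k s k≤s))))

  beta*2^k≤1 : ∀ k s → k ℕ.≤ s → beta k s * mkℚᵘ (+ (2 ℕ.^ k)) 0 ≤ 1ℚᵘ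
  beta*2^k≤1 k s k≤s = *≤* (subst₂ ℤ._≤_
    (trans (ℤₚ.pos-* (k ℕ.!) (2 ℕ.^ k)) (sym (ℤₚ.*-identityʳ _)))
    (sym (ℤₚ.*-identityˡ _))
    (ℤ.+≤+ (subst₂ ℕ._≤_ (ℕₚ.*-comm (2 ℕ.^ k) (k ℕ.!)) (sym (ℕₚ.*-identityʳ (rising k s))) (2^k*k!≤rising k s k≤s))))

  fractionalParts : List ℤ → ℕ → List ℚᵘ
  fractionalParts []       s = []
  fractionalParts (c ∷ cs) s = mkℚᵘ (+ (c %ℕ suc s)) s ∷ fractionalParts cs (suc s)

  integerPart : List ℤ → ℕ → ℤ
  integerPart []       s = + 0
  integerPart (c ∷ cs) s = c /ℕ suc s ℤ.+ integerPart cs (suc s)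

  length-fractionalParts : ∀ cs s → length (fractionalParts cs s) ≡ length cs
  length-fractionalParts []       s = refl
  length-fractionalParts (c ∷ cs) s = cong suc (length-fractionalParts cs (suc s))

  sumᵘ : List ℚᵘ → ℚᵘ
  sumᵘ = foldr _+_ 0ℚᵘ

  fraction-split : ∀ c s → mkℚᵘ c s ≃ mkℚᵘ (+ (c %ℕ suc s)) s + mkℚᵘ (c /ℕ suc s) 0
  fraction-split c s = *≡* (trans (cong (λ x → x ℤ.* (+ suc s ℤ.* + 1)) (a≡a%ℕn+[a/ℕn]*n c (suc s)))
                                  (cross (+ (c %ℕ suc s)) (c /ℕ suc s) (+ suc s)))
    where
    cross : ∀ r q d → (r ℤ.+ q ℤ.* d) ℤ.* (d ℤ.* + 1) ≡ (r ℤ.* + 1 ℤ.+ q ℤ.* d) ℤ.* d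
    cross = ℤ-solve

  integer-homo-+ : ∀ a b → mkℚᵘ (a ℤ.+ b) 0 ≃ mkℚᵘ a 0 + mkℚᵘ b 0
  integer-homo-+ a b = *≡* (cross a b)
    where
    cross : ∀ a b → (a ℤ.+ b) ℤ.* (+ 1 ℤ.* + 1) ≡ (a ℤ.* + 1 ℤ.+ b ℤ.* + 1) ℤ.* + 1
    cross = ℤ-solve

  moment-split : ∀ cs s → moment cs s ≃ sumᵘ (fractionalParts cs s) + mkℚᵘ (integerPart cs s) 0
  moment-split []       s = *≡* refl
  moment-split (c ∷ cs) s =
    ≃-trans (+-cong (fraction-split c s) (moment-split cs (suc s)))
      (≃-trans (rearrange r z (sumᵘ (fractionalParts cs (suc s))) (mkℚᵘ (integerPart cs (suc s)) 0))
               (+-congʳ (r + sumᵘ (fractionalParts cs (suc s)))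
                        (≃-sym (integer-homo-+ (c /ℕ suc s) (integerPart cs (suc s))))))
    where
    r = mkℚᵘ (+ (c %ℕ suc s)) s
    z = mkℚᵘ (c /ℕ suc s) 0
    rearrange : ∀ r z u w → (r + z) + (u + w) ≃ (r + u) + (z + w)
    rearrange = solve 4 (λ r z u w → (r :+ z) :+ (u :+ w) := (r :+ u) :+ (z :+ w)) ≃-refl

  UnitInterval : ℚᵘ → Set
  UnitInterval x = 0ℚᵘ ≤ x × x ≤ 1ℚᵘ

  fractionalParts-unit : ∀ cs s → All UnitInterval (fractionalParts cs s)
  fractionalParts-unit []       s = []
  fractionalParts-unit (c ∷ cs) s = (nonneg , ≤1) ∷ fractionalParts-unit cs (suc s)
    where
    r = c %ℕ suc s
    nonneg : 0ℚᵘ ≤ mkℚᵘ (+ r) s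
    nonneg = *≤* (subst (+ 0 ℤ.≤_) (sym (ℤₚ.*-identityʳ (+ r))) (ℤ.+≤+ ℕ.z≤n))
    ≤1 : mkℚᵘ (+ r) s ≤ 1ℚᵘ
    ≤1 = *≤* (subst₂ ℤ._≤_ (sym (ℤₚ.*-identityʳ (+ r))) (sym (ℤₚ.*-identityˡ (+ suc s)))
               (ℤ.+≤+ (ℕₚ.<⇒≤ (n%ℕd<d c (suc s)))))

  sumᵘ-bounds : ∀ xs → All UnitInterval xs → 0ℚᵘ ≤ sumᵘ xs × sumᵘ xs ≤ mkℚᵘ (+ length xs) 0
  sumᵘ-bounds []       []                 = ℚᵘₚ.≤-refl , ℚᵘₚ.≤-refl
  sumᵘ-bounds (x ∷ xs) ((0≤x , x≤1) ∷ us) with sumᵘ-bounds xs us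
  ... | 0≤Σ , Σ≤L =
    ℚᵘₚ.≤-respˡ-≃ (ℚᵘₚ.+-identityʳ 0ℚᵘ) (ℚᵘₚ.+-mono-≤ 0≤x 0≤Σ) ,
    ℚᵘₚ.≤-respʳ-≃ (*≡* (cross (+ length xs))) (ℚᵘₚ.+-mono-≤ x≤1 Σ≤L)
    where
    cross : ∀ L → (+ 1 ℤ.* + 1 ℤ.+ L ℤ.* + 1) ℤ.* + 1 ≡ (+ 1 ℤ.+ L) ℤ.* (+ 1 ℤ.* + 1)
    cross = ℤ-solve

  integer-bounds : ∀ z L {r v} → mkℚᵘ z 0 + r ≃ v → 0ℚᵘ < v → v ≤ 1ℚᵘ →
                   0ℚᵘ ≤ r → r ≤ mkℚᵘ (+ L) 0 → ℤ.- + L ℤ.< z × z ℤ.≤ + 1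
  integer-bounds z L {r} {v} z+r≃v 0<v v≤1 0≤r r≤L = -L<z , z≤1
    where
    z≤1 : z ℤ.≤ + 1
    z≤1 with ℚᵘₚ.≤-trans (ℚᵘₚ.≤-respˡ-≃ (ℚᵘₚ.+-identityʳ (mkℚᵘ z 0))
                 (ℚᵘₚ.≤-respʳ-≃ z+r≃v (ℚᵘₚ.+-monoʳ-≤ (mkℚᵘ z 0) 0≤r))) v≤1
    ... | *≤* z*1≤1 = subst₂ ℤ._≤_ (ℤₚ.*-identityʳ z) refl z*1≤1
    0<z+L : + 0 ℤ.< z ℤ.+ + L
    0<z+L with ℚᵘₚ.<-≤-trans (ℚᵘₚ.<-respʳ-≃ (≃-sym z+r≃v) 0<v) (ℚᵘₚ.+-monoʳ-≤ (mkℚᵘ z 0) r≤L)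
    ... | *<* 0<[z+L]*1 = subst (+ 0 ℤ.<_)
      (trans (ℤₚ.*-identityʳ _) (cong₂ ℤ._+_ (ℤₚ.*-identityʳ z) (ℤₚ.*-identityʳ (+ L)))) 0<[z+L]*1
    -L<z : ℤ.- + L ℤ.< z
    -L<z = subst₂ ℤ._<_ (ℤₚ.+-identityˡ (ℤ.- + L)) (cancel z (+ L)) (ℤₚ.+-monoˡ-< (ℤ.- + L) 0<z+L)
      where
      cancel : ∀ z L → z ℤ.+ L ℤ.+ ℤ.- L ≡ z
      cancel = ℤ-solve

  ∣z∣<n : ∀ z L n → ℤ.- + L ℤ.< z → z ℤ.≤ + 1 → L ℕ.< n → 1 ℕ.< n → ℤ.∣ z ∣ ℕ.< n
  ∣z∣<n (+ _)       L       n _           (ℤ.+≤+ z≤1) _   1<n = ℕₚ.≤-<-trans z≤1 1<n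
  ∣z∣<n ℤ.-[1+ _ ]  (suc L) n (ℤ.-<- z<L) _         L<n _ = ℕₚ.<-trans (ℕ.s≤s z<L) L<n

open BetaIntegral
open ℚᵘ using (ℚᵘ; mkℚᵘ; _≃_)
open ℚᵘₚ using (≃-refl; ≃-sym; ≃-trans; +-cong)
open ℚ using (ℚ; _<_; _≤_; _*_; _-_; 0ℚ; 1ℚ)

embed : (n : ℕ) → List ℚᵘ → Fin n → ℚ
embed n       []       _       = 0ℚ
embed zero    (x ∷ xs) ()
embed (suc n) (x ∷ xs) zero    = ℚ.fromℚᵘ x
embed (suc n) (x ∷ xs) (suc i) = embed n xs i

sumℚ-0 : ∀ n → sumℚ n (λ _ → 0ℚ) ≡ 0ℚ
sumℚ-0 zero    = refl
sumℚ-0 (suc n) = trans (ℚₚ.+-identityˡ _) (sumℚ-0 n)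

toℚᵘ-sumℚ-embed : ∀ n xs → length xs ℕ.≤ n → ℚ.toℚᵘ (sumℚ n (embed n xs)) ≃ sumᵘ xs
toℚᵘ-sumℚ-embed n       []       _            = ℚₚ.toℚᵘ-cong (sumℚ-0 n)
toℚᵘ-sumℚ-embed (suc n) (x ∷ xs) (ℕ.s≤s xs≤n) =
  ≃-trans (ℚₚ.toℚᵘ-homo-+ (ℚ.fromℚᵘ x) (sumℚ n (embed n xs)))
          (+-cong (ℚₚ.toℚᵘ-fromℚᵘ x) (toℚᵘ-sumℚ-embed n xs xs≤n))

toℚᵘ-homo-− : ∀ x y → ℚ.toℚᵘ (x - y) ≃ ℚ.toℚᵘ x ℚᵘ.- ℚ.toℚᵘ y
toℚᵘ-homo-− x y = ≃-trans (ℚₚ.toℚᵘ-homo-+ x (ℚ.- y)) (ℚᵘₚ.+-congʳ (ℚ.toℚᵘ x) (ℚₚ.toℚᵘ-homo‿- y))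

toℚᵘ-ℕtoℚ : ∀ m → ℚ.toℚᵘ (ℕtoℚ m) ≃ mkℚᵘ (+ m) 0
toℚᵘ-ℕtoℚ m = ℚₚ.toℚᵘ-fromℚᵘ (mkℚᵘ (+ m) 0)

embed-InQ : ∀ {W} n xs → All (λ x → InQ W (ℚ.fromℚᵘ x)) xs → InQ W 0ℚ → ∀ i → InQ W (embed n xs i)
embed-InQ n       []       _         0∈ _       = 0∈
embed-InQ (suc n) (x ∷ xs) (x∈ ∷ _)  _  zero    = x∈
embed-InQ (suc n) (x ∷ xs) (_ ∷ xs∈) 0∈ (suc i) = embed-InQ n xs xs∈ 0∈ i

0∈ℚ[n] : ∀ n → 1 ℕ.< n → InQ n 0ℚ
0∈ℚ[n] n 1<n = + 0 , 0 , ℕₚ.<-trans (ℕ.s≤s ℕ.z≤n) 1<n , 1<n , refl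

fractionalParts-InQ : ∀ cs s W → s ℕ.+ length cs ℕ.< W →
                      All (λ x → InQ W (ℚ.fromℚᵘ x)) (fractionalParts cs s)
fractionalParts-InQ []       s W _ = []
fractionalParts-InQ (c ∷ cs) s W s+len<W =
  (+ (c %ℕ suc s) , s , ℕₚ.<-trans (n%ℕd<d c (suc s)) s<W , s<W , refl)
  ∷ fractionalParts-InQ cs (suc s) W s+1+len<W
  where
  s+1+len<W : suc s ℕ.+ length cs ℕ.< W
  s+1+len<W = subst (ℕ._< W) (ℕₚ.+-suc s (length cs)) s+len<W
  s<W : suc s ℕ.< W
  s<W = ℕₚ.≤-<-trans (ℕ.s≤s (ℕₚ.m≤m+n s (length cs))) s+1+len<W

SmallGap : ℕ → ℕ → Set
SmallGap n k = Σ (Fin n → ℚ) λ p → Σ (Fin n → ℚ) λ q →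
  ((i : Fin n) → InQ n (p i)) × ((i : Fin n) → InQ n (q i)) ×
  (0ℚ < (sumℚ n p - sumℚ n q)) × ((sumℚ n p - sumℚ n q) * ℕtoℚ (2 ^ k) ≤ 1ℚ)

smallGap : ∀ n k → k ℕ.+ suc k ℕ.< n → SmallGap n k
smallGap n k 2k+1<n =
  embed n xs , embed n ys ,
  embed-InQ n xs (fractionalParts-InQ cs k n k+len<n) (0∈ℚ[n] n 1<n) ,
  embed-InQ n ys ((ℤ.- z , 0 , ∣-z∣<n , 1<n , refl) ∷ []) (0∈ℚ[n] n 1<n) ,
  ℚₚ.toℚᵘ-cancel-< (ℚᵘₚ.<-respʳ-≃ (≃-sym gap≃beta) (beta-positive k k)) ,
  ℚₚ.toℚᵘ-cancel-≤ (ℚᵘₚ.≤-respˡ-≃ (≃-sym gap*2^k≃beta*2^k) (beta*2^k≤1 k k ℕₚ.≤-refl))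
  where
  cs = oneMinusXPow k
  xs = fractionalParts cs k
  z = integerPart cs k
  ys = mkℚᵘ (ℤ.- z) 0 ∷ []
  p = embed n xs
  q = embed n ys

  length-xs : length xs ≡ suc k
  length-xs = trans (length-fractionalParts cs k) (length-oneMinusXPow k)
  k+len<n : k ℕ.+ length cs ℕ.< n
  k+len<n = subst (λ L → k ℕ.+ L ℕ.< n) (sym (length-oneMinusXPow k)) 2k+1<n
  k+1<n : suc k ℕ.< n
  k+1<n = ℕₚ.≤-<-trans (ℕₚ.m≤n+m (suc k) k) 2k+1<n
  1<n : 1 ℕ.< n
  1<n = ℕₚ.≤-<-trans (ℕ.s≤s ℕ.z≤n) k+1<n

  z+Σxs≃beta : mkℚᵘ z 0 ℚᵘ.+ sumᵘ xs ≃ beta k k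
  z+Σxs≃beta = begin
    mkℚᵘ z 0 ℚᵘ.+ sumᵘ xs  ≈⟨ ℚᵘₚ.+-comm (mkℚᵘ z 0) (sumᵘ xs) ⟩
    sumᵘ xs ℚᵘ.+ mkℚᵘ z 0  ≈⟨ moment-split cs k ⟨
    moment cs k            ≈⟨ moment-oneMinusXPow k k ⟩
    beta k k               ∎
    where open ℚᵘₚ.≃-Reasoning
  ∣-z∣<n : ℤ.∣ ℤ.- z ∣ ℕ.< n
  ∣-z∣<n with sumᵘ-bounds xs (fractionalParts-unit cs k)
  ... | 0≤Σxs , Σxs≤len with integer-bounds z (suc k) z+Σxs≃beta (beta-positive k k) (beta≤1 k k ℕₚ.≤-refl)
                              0≤Σxs (subst (λ L → sumᵘ xs ℚᵘ.≤ mkℚᵘ (+ L) 0) length-xs Σxs≤len)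
  ... | -L<z , z≤1 = subst (ℕ._< n) (sym (ℤₚ.∣-i∣≡∣i∣ z)) (∣z∣<n z (suc k) n -L<z z≤1 k+1<n 1<n)

  gap≃beta : ℚ.toℚᵘ (sumℚ n p - sumℚ n q) ≃ beta k k
  gap≃beta = begin
    ℚ.toℚᵘ (sumℚ n p - sumℚ n q)              ≈⟨ toℚᵘ-homo-− (sumℚ n p) (sumℚ n q) ⟩
    ℚ.toℚᵘ (sumℚ n p) ℚᵘ.- ℚ.toℚᵘ (sumℚ n q)  ≈⟨ +-cong (toℚᵘ-sumℚ-embed n xs xs≤n)
                                                          (ℚᵘₚ.-‿cong (toℚᵘ-sumℚ-embed n ys ys≤n)) ⟩
    sumᵘ xs ℚᵘ.- sumᵘ ys                      ≈⟨ rearrange (sumᵘ xs) (mkℚᵘ z 0) ⟩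
    mkℚᵘ z 0 ℚᵘ.+ sumᵘ xs                     ≈⟨ z+Σxs≃beta ⟩
    beta k k                                  ∎
    where
    open ℚᵘₚ.≃-Reasoning
    open +-*-Solver using (solve; _:=_; _:+_; _:-_; :-_; con)
    xs≤n : length xs ℕ.≤ n
    xs≤n = ℕₚ.≤-trans (ℕₚ.≤-reflexive length-xs) (ℕₚ.<⇒≤ k+1<n)
    ys≤n : length ys ℕ.≤ n
    ys≤n = ℕₚ.<⇒≤ 1<n
    rearrange : ∀ x w → x ℚᵘ.- (ℚᵘ.- w ℚᵘ.+ ℚᵘ.0ℚᵘ) ≃ w ℚᵘ.+ x
    rearrange = solve 2 (λ x w → x :- ((:- w) :+ con ℚᵘ.0ℚᵘ) := w :+ x) ≃-refl

  gap*2^k≃beta*2^k : ℚ.toℚᵘ ((sumℚ n p - sumℚ n q) * ℕtoℚ (2 ^ k)) ≃ beta k k ℚᵘ.* mkℚᵘ (+ (2 ^ k)) 0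
  gap*2^k≃beta*2^k = ≃-trans (ℚₚ.toℚᵘ-homo-* (sumℚ n p - sumℚ n q) (ℕtoℚ (2 ^ k)))
                             (ℚᵘₚ.*-cong gap≃beta (toℚᵘ-ℕtoℚ (2 ^ k)))

quarter-bounds : ∀ n → 4 ℕ.≤ n → n ℕ./ 4 ℕ.+ suc (n ℕ./ 4) ℕ.< n × n ℕ.≤ n ℕ./ 4 ℕ.* 8
quarter-bounds n 4≤n =
  bounds (n ℕ.% 4) (n ℕ./ 4) (m%n<n n 4) (m≡m%n+[m/n]*n n 4) (/-monoˡ-≤ 4 4≤n)
  where
  open ℕₚ.≤-Reasoning
  bounds : ∀ r k → r ℕ.< 4 → n ≡ r ℕ.+ k ℕ.* 4 → 1 ℕ.≤ k → k ℕ.+ suc k ℕ.< n × n ℕ.≤ k ℕ.* 8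
  bounds r zero    _   _      ()
  bounds r (suc j) r<4 n≡r+4k _ = 2k+1<n , n≤8k
    where
    k = suc j
    expand : ∀ j → suc (suc j ℕ.+ suc (suc j)) ℕ.+ 2 ℕ.* j ≡ suc j ℕ.* 4
    expand = ℕ-solve
    2k+1<n : k ℕ.+ suc k ℕ.< n
    2k+1<n = begin-strict
      k ℕ.+ suc k                    <⟨ ℕₚ.n<1+n _ ⟩
      suc (k ℕ.+ suc k)              ≤⟨ ℕₚ.m≤m+n _ (2 ℕ.* j) ⟩
      suc (k ℕ.+ suc k) ℕ.+ 2 ℕ.* j  ≡⟨ expand j ⟩
      k ℕ.* 4                        ≤⟨ ℕₚ.m≤n+m (k ℕ.* 4) r ⟩
      r ℕ.+ k ℕ.* 4                  ≡⟨ n≡r+4k ⟨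
      n                              ∎
    n≤8k : n ℕ.≤ k ℕ.* 8
    n≤8k = begin
      n                    ≡⟨ n≡r+4k ⟩
      r ℕ.+ k ℕ.* 4        ≤⟨ ℕₚ.+-monoˡ-≤ (k ℕ.* 4) (ℕₚ.≤-trans (ℕₚ.<⇒≤ r<4) (ℕₚ.m≤m+n 4 (j ℕ.* 4))) ⟩
      k ℕ.* 4 ℕ.+ k ℕ.* 4  ≡⟨ ℕₚ.*-distribˡ-+ k 4 4 ⟨
      k ℕ.* 8              ∎

1≤⌈log₂⌉ : ∀ n → 1 ℕ.< n → 1 ℕ.≤ ⌈log₂ n ⌉
1≤⌈log₂⌉ n 1<n = ℕₚ.≤-trans (ℕₚ.≤-reflexive (sym (⌈log₂2^n⌉≡n 1))) (⌈log₂⌉-mono-≤ 1<n)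

eighth*n≤m : ∀ n m → n ℕ.≤ m ℕ.* 8 → (+ 1 ℚ./ 8) * ℕtoℚ n ≤ ℕtoℚ m
eighth*n≤m n m n≤8m = ℚₚ.toℚᵘ-cancel-≤ (ℚᵘₚ.≤-respʳ-≃ (≃-sym (toℚᵘ-ℕtoℚ m))
  (ℚᵘₚ.≤-respˡ-≃ (≃-sym (≃-trans (ℚₚ.toℚᵘ-homo-* (+ 1 ℚ./ 8) (ℕtoℚ n))
                                 (ℚᵘₚ.*-cong (ℚₚ.toℚᵘ-fromℚᵘ (mkℚᵘ (+ 1) 7)) (toℚᵘ-ℕtoℚ n))))
    (ℚᵘ.*≤* (subst₂ ℤ._≤_ (sym (trans (ℤₚ.*-identityʳ _) (ℤₚ.*-identityˡ (+ n)))) (ℤₚ.pos-* m 8) (ℤ.+≤+ n≤8m)))))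

mainTheorem17 : Σ ℚ λ c → (0ℚ < c) × (Σ ℕ λ N → (n : ℕ) → n ≥ N →
    Σ (Fin n → ℚ) λ p → Σ (Fin n → ℚ) λ q →
    ((i : Fin n) → InQ n (p i)) × ((i : Fin n) → InQ n (q i)) ×
    (0ℚ < (sumℚ n p - sumℚ n q)) ×
    (Σ ℕ λ k → (c * ℕtoℚ n ≤ ℕtoℚ (k *ℕ ⌈log₂ n ⌉)) ×
    ((sumℚ n p - sumℚ n q) * ℕtoℚ (2 ^ k) ≤ 1ℚ)))
mainTheorem17 = + 1 ℚ./ 8 , ℚ.*<* (ℤ.+<+ (ℕ.s≤s ℕ.z≤n)) , 4 , λ n 4≤n →
  let k = n ℕ./ 4
      2k+1<n , n≤8k = quarter-bounds n 4≤n
      p , q , p∈ , q∈ , 0<gap , gap≤2⁻ᵏ = smallGap n k 2k+1<n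
      L≥1 = 1≤⌈log₂⌉ n (ℕₚ.<-≤-trans (ℕ.s≤s (ℕ.s≤s ℕ.z≤n)) 4≤n)
      n≤8kL = ℕₚ.≤-trans n≤8k (ℕₚ.*-monoˡ-≤ 8 (ℕₚ.m≤m*n k ⌈log₂ n ⌉ {{ℕ.>-nonZero L≥1}}))
  in p , q , p∈ , q∈ , 0<gap , k , eighth*n≤m n (k *ℕ ⌈log₂ n ⌉) n≤8kL , gap≤2⁻ᵏ
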